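{- Let $T$ be a directed tree of order $n$ and let $q$ be the number of sources of $T$. Then $\gamma(T)\le\lfloor (n+q)/2\rfloor$.
   Context: A directed tree is a digraph (finite, no loops or multiple arcs) whose underlying graph is a tree. A source is a vertex of in-degree $0$. A set $S\subseteq V(D)$ is a dominating set of a digraph $D$ if every vertex of $V(D)\setminus S$ has an in-neighbor in $S$; $\gamma(D)$ is the minimum cardinality of a dominating set. -}

module Defs where

open import Data.Nat using (ℕ; zero; suc; _+_; _∸_)
open import Data.Bool using (Bool; true; false; T)
open import Data.Fin using (Fin)
open import Data.Fin.Subset using (Subset; _∈_; _∉_)
open import Data.List using (List; []; _∷_; length; filter; allFin; concatMap; map)
open import Data.Product using (Σ; ∃; _×_; _,_)
open import Data.Sum using (_⊎_)
open import Relation.Nullary using (¬_)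
open import Relation.Binary.PropositionalEquality using (_≡_)
open import Data.Bool.Properties using (T?)

-- A digraph on the vertex set Fin n, given by a (decidable) arc relation.
-- Using a relation excludes multiple arcs by construction.
record Digraph (n : ℕ) : Set where
  field
    arc : Fin n → Fin n → Bool
open Digraph public

Arc : ∀ {n} → Digraph n → Fin n → Fin n → Set
Arc D u v = T (arc D u v)

Adj : ∀ {n} → Digraph n → Fin n → Fin n → Set
Adj D u v = Arc D u v ⊎ Arc D v u

data Walk {n : ℕ} (D : Digraph n) : Fin n → Fin n → Set where
  here : ∀ {u} → Walk D u u
  step : ∀ {u v w} → Adj D u v → Walk D v w → Walk D u w

arcs : ∀ {n} → Digraph n → List (Fin n × Fin n)
arcs {n} D = filter (λ p → T? (arc D (Data.Product.proj₁ p) (Data.Product.proj₂ p)))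
                    (concatMap (λ u → map (λ v → (u , v)) (allFin n)) (allFin n))

numArcs : ∀ {n} → Digraph n → ℕ
numArcs D = length (arcs D)

-- A directed tree: no loops, no pair of opposite arcs (so the underlying graph
-- is a simple graph with one edge per arc), at least one vertex, the
-- underlying graph is connected and has n - 1 edges.
record IsDirectedTree {n : ℕ} (D : Digraph n) : Set where
  field
    nonempty   : Fin n
    loopless   : ∀ u → ¬ Arc D u u
    antisym    : ∀ u v → Arc D u v → ¬ Arc D v u
    connected  : ∀ u v → Walk D u v
    edgeCount  : numArcs D ≡ n ∸ 1

IsSource : ∀ {n} → Digraph n → Fin n → Set
IsSource D v = ∀ u → ¬ Arc D u v

sources : ∀ {n} → Digraph n → List (Fin n)
sources {n} D = filter (λ v → Data.List.Relation.Unary.All.all? (λ u → Relation.Nullary.¬? (T? (arc D u v))) (allFin n)) (allFin n)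
  where import Data.List.Relation.Unary.All
        import Relation.Nullary

numSources : ∀ {n} → Digraph n → ℕ
numSources D = length (sources D)

IsDominating : ∀ {n} → Digraph n → Subset n → Set
IsDominating D S = ∀ v → v ∉ S → ∃ λ u → u ∈ S × Arc D u v

-- A directed tree is bipartite: its underlying graph is connected with n - 1 edges, so a
-- union-find run over its arcs merges two components at every arc, and recolouring one side
-- of each merge keeps the 2-colouring proper. For either colour class C, the set C ∪ sources
-- dominates: a vertex outside it has an in-neighbour, of the other colour, hence in C.
-- The two sets have sizes summing to n + q, so the smaller one has at most (n + q)/2 vertices.
module Submission where

open import Defs
open import Data.Nat using (ℕ; _+_; _≤_; _/_)
open import Data.Fin.Subset using (Subset; ∣_∣)
open import Data.Product using (∃; _×_)

open import Algebra.Bundles using (CommutativeRing)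
open import Data.Bool using (Bool; true; false; not; _xor_; _∧_; if_then_else_)
open import Data.Bool.Properties
  using (T?; ¬-not; not-injective; xor-identityʳ; xor-∧-commutativeRing)
open import Data.Fin using (Fin; _≟_)
open import Data.Fin.Properties using (any?)
open import Data.Fin.Subset using (_∈_; _∉_; _⊆_; _─_; _-_; _∪_; ∁; ⊤; ⁅_⁆; inside; outside)
open import Data.Fin.Subset.Properties
  using (∈⊤; ∣⊤∣≡n; p─⊥≡p; p─q⊆p; x∈p∧x≢y⇒x∈p-y; x∉⁅y⁆⇒x≢y; x∈⁅y⁆⇔x≡y; ∣⁅x⁆∣≡1;
         p⊆q⇒∣p∣≤∣q∣; x∈p∪q⁺; p⊆p∪q; q⊆p∪q)
open import Data.List using (List; []; _∷_; length; filter; allFin; map)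
import Data.List as List
open import Data.List.Membership.Propositional using (lose) renaming (_∈_ to _∈ˡ_)
open import Data.List.Membership.Propositional.Properties
  using (∈-filter⁺; ∈-concatMap⁺; ∈-map⁺; ∈-allFin)
open import Data.List.Relation.Unary.Any using (here; there)
import Data.List.Relation.Unary.All as All
open import Data.Nat using (zero; suc; _*_; _∸_; z≤n; s≤s)
open import Data.Nat.DivMod using (m*n/n≡m; /-monoˡ-≤)
open import Data.Nat.Properties hiding (_≟_)
open import Data.Product using (_,_; proj₁; proj₂)
open import Data.Sum using (_⊎_; inj₁; inj₂)
open import Data.Vec using ([]; _∷_; tabulate; here; there)
open import Data.Vec.Properties using (lookup⇒[]=; lookup∘tabulate; tabulate-∘)
open import Function using (_∘_; id; Equivalence)
open import Relation.Binary.PropositionalEquality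
open import Relation.Nullary using (¬_; yes; no; does; ¬?; contradiction)
open import Relation.Nullary.Decidable using (dec-true; dec-false)
open import Relation.Unary using (Decidable)

open import Algebra.Properties.Group (CommutativeRing.+-group xor-∧-commutativeRing)
  using () renaming (∙-cancelʳ to xor-cancelʳ)

private
  variable
    n : ℕ

x∈p─q⇒x∉q : ∀ {x} (p q : Subset n) → x ∈ p ─ q → x ∉ q
x∈p─q⇒x∉q (_ ∷ p) (outside ∷ q) here        = λ ()
x∈p─q⇒x∉q (_ ∷ p) (outside ∷ q) (there x∈) = λ { (there x∈q) → x∈p─q⇒x∉q p q x∈ x∈q }
x∈p─q⇒x∉q (_ ∷ p) (inside  ∷ q) (there x∈) = λ { (there x∈q) → x∈p─q⇒x∉q p q x∈ x∈q }

x∈p-y⇒x≢y : ∀ {x} (p : Subset n) y → x ∈ p - y → x ≢ y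
x∈p-y⇒x≢y p y = x∉⁅y⁆⇒x≢y ∘ x∈p─q⇒x∉q p ⁅ y ⁆

x∈p⇒∣p∣≡1+∣p-x∣ : ∀ {x} {p : Subset n} → x ∈ p → ∣ p ∣ ≡ suc ∣ p - x ∣
x∈p⇒∣p∣≡1+∣p-x∣ {p = _ ∷ p}       here       = cong (suc ∘ ∣_∣) (sym (p─⊥≡p p))
x∈p⇒∣p∣≡1+∣p-x∣ {p = inside  ∷ _} (there x∈) = cong suc (x∈p⇒∣p∣≡1+∣p-x∣ x∈)
x∈p⇒∣p∣≡1+∣p-x∣ {p = outside ∷ _} (there x∈) = x∈p⇒∣p∣≡1+∣p-x∣ x∈

∣p∪q∣+∣∁p∪q∣≡n+∣q∣ : ∀ (p q : Subset n) → ∣ p ∪ q ∣ + ∣ ∁ p ∪ q ∣ ≡ n + ∣ q ∣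
∣p∪q∣+∣∁p∪q∣≡n+∣q∣ []            []            = refl
∣p∪q∣+∣∁p∪q∣≡n+∣q∣ (inside  ∷ p) (outside ∷ q) = cong suc (∣p∪q∣+∣∁p∪q∣≡n+∣q∣ p q)
∣p∪q∣+∣∁p∪q∣≡n+∣q∣ (outside ∷ p) (outside ∷ q) =
  trans (+-suc _ _) (cong suc (∣p∪q∣+∣∁p∪q∣≡n+∣q∣ p q))
∣p∪q∣+∣∁p∪q∣≡n+∣q∣ (inside  ∷ p) (inside  ∷ q) =
  cong suc (trans (+-suc _ _) (trans (cong suc (∣p∪q∣+∣∁p∪q∣≡n+∣q∣ p q)) (sym (+-suc _ _))))
∣p∪q∣+∣∁p∪q∣≡n+∣q∣ (outside ∷ p) (inside  ∷ q) =
  cong suc (trans (+-suc _ _) (trans (cong suc (∣p∪q∣+∣∁p∪q∣≡n+∣q∣ p q)) (sym (+-suc _ _))))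

∈-tabulate⁺ : ∀ {f : Fin n → Bool} {x} → f x ≡ true → x ∈ tabulate f
∈-tabulate⁺ {f = f} {x} fx≡true = lookup⇒[]= x (tabulate f) (trans (lookup∘tabulate f x) fx≡true)

∣tabulate∣≡length∘filter : ∀ {A : Set} {P : A → Set} (P? : Decidable P) (g : Fin n → A) →
  ∣ tabulate (does ∘ P? ∘ g) ∣ ≡ length (filter P? (List.tabulate g))
∣tabulate∣≡length∘filter {n = zero}  P? g = refl
∣tabulate∣≡length∘filter {n = suc n} P? g with does (P? (g Fin.zero))
... | true  = cong suc (∣tabulate∣≡length∘filter P? (g ∘ Fin.suc))
... | false = ∣tabulate∣≡length∘filter P? (g ∘ Fin.suc)

module _ {n : ℕ} where

  Edges : Set
  Edges = List (Fin n × Fin n)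

  ProperOn : Edges → (Fin n → Bool) → Set
  ProperOn es c = ∀ {u v} → (u , v) ∈ˡ es → c u ≢ c v

  -- A union-find run over es: root picks a representative of each component of the graph
  -- (Fin n, es), merges counts the edges that joined two components, and the colouring is
  -- proper as soon as every edge did.
  record UnionFind (es : Edges) : Set where
    field
      root             : Fin n → Fin n
      roots            : Subset n
      colour           : Fin n → Bool
      merges           : ℕ
      root∈roots       : ∀ v → root v ∈ roots
      root-fixes-roots : ∀ {r} → r ∈ roots → root r ≡ r
      root-edge        : ∀ {u v} → (u , v) ∈ˡ es → root u ≡ root v
      ∣roots∣+merges≡n : ∣ roots ∣ + merges ≡ n
      merges≤length    : merges ≤ length es
      proper-if-forest : merges ≡ length es → ProperOn es colour

  empty : UnionFind []
  empty = record
    { root = λ v → v ; roots = ⊤ ; colour = λ _ → false ; merges = 0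
    ; root∈roots = λ _ → ∈⊤ ; root-fixes-roots = λ _ → refl ; root-edge = λ ()
    ; ∣roots∣+merges≡n = trans (+-identityʳ _) (∣⊤∣≡n n)
    ; merges≤length = z≤n ; proper-if-forest = λ _ () }

  module Merge {es : Edges} (F : UnionFind es) {a b : Fin n}
               (ra≢rb : UnionFind.root F a ≢ UnionFind.root F b) where
    open UnionFind F

    ra rb : Fin n
    ra = root a
    rb = root b

    relabel : Fin n → Fin n
    relabel r = if does (r ≟ rb) then ra else r

    relabel-rb : relabel rb ≡ ra
    relabel-rb rewrite dec-true (rb ≟ rb) refl = refl

    relabel-≢ : ∀ {r} → r ≢ rb → relabel r ≡ r
    relabel-≢ {r} r≢rb rewrite dec-false (r ≟ rb) r≢rb = refl

    relabel-∈ : ∀ {r} → r ∈ roots → relabel r ∈ roots - rb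
    relabel-∈ {r} r∈roots with r ≟ rb
    ... | yes _    = x∈p∧x≢y⇒x∈p-y (root∈roots a) ra≢rb
    ... | no r≢rb  = x∈p∧x≢y⇒x∈p-y r∈roots r≢rb

    -- The component of b is recoloured by xor with flip, which makes the colours of a and b differ.
    flip : Bool
    flip = not (colour a xor colour b)

    recolouring : Fin n → Bool
    recolouring r = does (r ≟ rb) ∧ flip

    colour′ : Fin n → Bool
    colour′ v = colour v xor recolouring (root v)

    colour′-ab : colour′ a ≢ colour′ b
    colour′-ab rewrite dec-false (ra ≟ rb) ra≢rb | dec-true (rb ≟ rb) refl
                     | xor-identityʳ (colour a) = x≢y-xor-not[x-xor-y] (colour a) (colour b)
      where
        x≢y-xor-not[x-xor-y] : ∀ x y → x ≢ y xor not (x xor y)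
        x≢y-xor-not[x-xor-y] true  true  ()
        x≢y-xor-not[x-xor-y] true  false ()
        x≢y-xor-not[x-xor-y] false true  ()
        x≢y-xor-not[x-xor-y] false false ()

    colour′-same-root : ∀ {u v} → root u ≡ root v → colour u ≢ colour v → colour′ u ≢ colour′ v
    colour′-same-root {u} {v} ru≡rv cu≢cv eq =
      cu≢cv (xor-cancelʳ (recolouring (root v)) (colour u) (colour v)
               (subst (λ r → colour u xor recolouring r ≡ colour′ v) ru≡rv eq))

    merged : UnionFind ((a , b) ∷ es)
    merged = record
      { root             = relabel ∘ root
      ; roots            = roots - rb
      ; colour           = colour′
      ; merges           = suc merges
      ; root∈roots       = λ v → relabel-∈ (root∈roots v)
      ; root-fixes-roots = λ {r} r∈ →
          trans (cong relabel (root-fixes-roots (p─q⊆p roots ⁅ rb ⁆ r∈)))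
                (relabel-≢ (x∈p-y⇒x≢y roots rb r∈))
      ; root-edge        = λ { (here refl) → trans (relabel-≢ ra≢rb) (sym relabel-rb)
                             ; (there e)   → cong relabel (root-edge e) }
      ; ∣roots∣+merges≡n =
          trans (+-suc _ merges)
                (trans (cong (_+ merges) (sym (x∈p⇒∣p∣≡1+∣p-x∣ (root∈roots b)))) ∣roots∣+merges≡n)
      ; merges≤length    = s≤s merges≤length
      ; proper-if-forest = λ { _ (here refl) → colour′-ab
                             ; eq (there e) → colour′-same-root (root-edge e)
                                                 (proper-if-forest (suc-injective eq) e) }
      }

  open UnionFind

  skip : ∀ {es} (F : UnionFind es) {a b : Fin n} → root F a ≡ root F b → UnionFind ((a , b) ∷ es)
  skip F ra≡rb = record
    { root             = root F
    ; roots            = roots F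
    ; colour           = colour F
    ; merges           = merges F
    ; root∈roots       = root∈roots F
    ; root-fixes-roots = root-fixes-roots F
    ; root-edge        = λ { (here refl) → ra≡rb ; (there e) → root-edge F e }
    ; ∣roots∣+merges≡n = ∣roots∣+merges≡n F
    ; merges≤length    = m≤n⇒m≤1+n (merges≤length F)
    ; proper-if-forest = λ eq → contradiction eq (<⇒≢ (s≤s (merges≤length F)))
    }

  unionFind : (es : Edges) → UnionFind es
  unionFind []            = empty
  unionFind ((a , b) ∷ es) with unionFind es
  ... | F with root F a ≟ root F b
  ... | yes ra≡rb = skip F ra≡rb
  ... | no  ra≢rb = Merge.merged F ra≢rb

  single-component⇒∣roots∣≤1 : ∀ {es} (F : UnionFind es) → Fin n →
    (∀ u v → root F u ≡ root F v) → ∣ roots F ∣ ≤ 1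
  single-component⇒∣roots∣≤1 F x sameRoot =
    subst (∣ roots F ∣ ≤_) (∣⁅x⁆∣≡1 (root F x)) (p⊆q⇒∣p∣≤∣q∣ roots⊆⁅rx⁆)
    where
      roots⊆⁅rx⁆ : roots F ⊆ ⁅ root F x ⁆
      roots⊆⁅rx⁆ {r} r∈ = Equivalence.from x∈⁅y⁆⇔x≡y
        (trans (sym (root-fixes-roots F r∈)) (sameRoot r x))

  -- With at most one component left, n ≤ 1 + merges, so no edge can have been skipped.
  spanning-tree-proper : ∀ {es} (F : UnionFind es) → ∣ roots F ∣ ≤ 1 → length es ≤ n ∸ 1 →
    ProperOn es (colour F)
  spanning-tree-proper F ∣roots∣≤1 length≤ = proper-if-forest F
    (≤-antisym (merges≤length F) (≤-trans length≤ (m≤n+o⇒m∸n≤o n 1 n≤1+merges)))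
    where
      n≤1+merges : n ≤ 1 + merges F
      n≤1+merges = subst (_≤ 1 + merges F) (∣roots∣+merges≡n F) (+-monoˡ-≤ (merges F) ∣roots∣≤1)

m≤n⇒m≤[m+n]/2 : ∀ {m n} → m ≤ n → m ≤ (m + n) / 2
m≤n⇒m≤[m+n]/2 {m} {n} m≤n = begin
  m           ≡⟨ m*n/n≡m m 2 ⟨
  m * 2 / 2   ≡⟨ cong (_/ 2) (trans (*-comm m 2) (cong (m +_) (+-identityʳ m))) ⟩
  (m + m) / 2 ≤⟨ /-monoˡ-≤ 2 (+-monoʳ-≤ m m≤n) ⟩
  (m + n) / 2 ∎
  where open ≤-Reasoning

summand≤half : ∀ {a b s} → a + b ≡ s → a ≤ s / 2 ⊎ b ≤ s / 2
summand≤half {a} {b} a+b≡s with ≤-total a b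
... | inj₁ a≤b = inj₁ (subst (λ s → a ≤ s / 2) a+b≡s (m≤n⇒m≤[m+n]/2 a≤b))
... | inj₂ b≤a = inj₂ (subst (λ s → b ≤ s / 2) (trans (+-comm b a) a+b≡s) (m≤n⇒m≤[m+n]/2 b≤a))

module _ {n : ℕ} (D : Digraph n) where
  open UnionFind

  ProperColouring : (Fin n → Bool) → Set
  ProperColouring c = ∀ {u v} → Arc D u v → c u ≢ c v

  Arc⇒∈arcs : ∀ {u v} → Arc D u v → (u , v) ∈ˡ arcs D
  Arc⇒∈arcs {u} {v} u→v = ∈-filter⁺ (λ p → T? (arc D (proj₁ p) (proj₂ p)))
    (∈-concatMap⁺ (λ u′ → map (u′ ,_) (allFin n)) (lose (∈-allFin u) (∈-map⁺ (u ,_) (∈-allFin v))))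
    u→v

  Walk⇒sameRoot : (F : UnionFind (arcs D)) → ∀ {u v} → Walk D u v → root F u ≡ root F v
  Walk⇒sameRoot F here                  = refl
  Walk⇒sameRoot F (step (inj₁ u→w) w⇝v) = trans (root-edge F (Arc⇒∈arcs u→w)) (Walk⇒sameRoot F w⇝v)
  Walk⇒sameRoot F (step (inj₂ w→u) w⇝v) = trans (sym (root-edge F (Arc⇒∈arcs w→u))) (Walk⇒sameRoot F w⇝v)

  directedTree-properColouring : IsDirectedTree D → ∃ ProperColouring
  directedTree-properColouring tree = colour F , proper ∘ Arc⇒∈arcs
    where
      open IsDirectedTree tree
      F : UnionFind (arcs D)
      F = unionFind (arcs D)
      proper : ProperOn (arcs D) (colour F)
      proper = spanning-tree-proper F
        (single-component⇒∣roots∣≤1 F nonempty (λ u v → Walk⇒sameRoot F (connected u v)))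
        (≤-reflexive edgeCount)

  -- The decision procedure used in the definition of sources, so that the counts agree.
  isSource? : Decidable (λ v → All.All (λ u → ¬ Arc D u v) (allFin n))
  isSource? v = All.all? (λ u → ¬? (T? (arc D u v))) (allFin n)

  sourceSet : Subset n
  sourceSet = tabulate (does ∘ isSource?)

  ∣sourceSet∣≡numSources : ∣ sourceSet ∣ ≡ numSources D
  ∣sourceSet∣≡numSources = ∣tabulate∣≡length∘filter isSource? id

  ∉sourceSet⇒inNeighbour : ∀ {v} → v ∉ sourceSet → ∃ λ u → Arc D u v
  ∉sourceSet⇒inNeighbour {v} v∉ with any? (λ u → T? (arc D u v))
  ... | yes inNeighbour = inNeighbour
  ... | no  noInNeighbour = contradiction
    (∈-tabulate⁺ (dec-true (isSource? v) (All.universal (λ u u→v → noInNeighbour (u , u→v)) (allFin n))))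
    v∉

  colourClass∪sources-dominating : ∀ {c} → ProperColouring c → IsDominating D (tabulate c ∪ sourceSet)
  colourClass∪sources-dominating {c} proper v v∉ with ∉sourceSet⇒inNeighbour (v∉ ∘ q⊆p∪q _ sourceSet)
  ... | u , u→v = u , p⊆p∪q sourceSet (∈-tabulate⁺ cu≡true) , u→v
    where
      cv≡false : c v ≡ false
      cv≡false = ¬-not (v∉ ∘ p⊆p∪q sourceSet ∘ ∈-tabulate⁺)
      cu≡true : c u ≡ true
      cu≡true = trans (¬-not (proper u→v)) (cong not cv≡false)

  ∣colourClasses∪sources∣ : ∀ c →
    ∣ tabulate c ∪ sourceSet ∣ + ∣ tabulate (not ∘ c) ∪ sourceSet ∣ ≡ n + numSources D
  ∣colourClasses∪sources∣ c = begin
    ∣ tabulate c ∪ sourceSet ∣ + ∣ tabulate (not ∘ c) ∪ sourceSet ∣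
      ≡⟨ cong (λ C → ∣ tabulate c ∪ sourceSet ∣ + ∣ C ∪ sourceSet ∣) (tabulate-∘ not c) ⟩
    ∣ tabulate c ∪ sourceSet ∣ + ∣ ∁ (tabulate c) ∪ sourceSet ∣
      ≡⟨ ∣p∪q∣+∣∁p∪q∣≡n+∣q∣ (tabulate c) sourceSet ⟩
    n + ∣ sourceSet ∣
      ≡⟨ cong (n +_) ∣sourceSet∣≡numSources ⟩
    n + numSources D ∎
    where open ≡-Reasoning

corollary2 : (n : ℕ) (D : Digraph n) → IsDirectedTree D →
    ∃ λ (S : Subset n) → IsDominating D S × ∣ S ∣ ≤ (n + numSources D) / 2
corollary2 n D tree
  with c , proper ← directedTree-properColouring D tree
  with summand≤half (∣colourClasses∪sources∣ D c)
... | inj₁ small = tabulate c ∪ sourceSet D , colourClass∪sources-dominating D proper , small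
... | inj₂ small = tabulate (not ∘ c) ∪ sourceSet D
                 , colourClass∪sources-dominating D (λ u→v → proper u→v ∘ not-injective) , small
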